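{- For $k\geq 2$ and $0\le j\le k-1$, $B_{k,j}$ is nonzero if $j\neq 0$ and $k$ and $j$ do not have the same parity. Moreover the $B_{k,j}$ satisfy \[ B_{2,1}=2,\qquad B_{3,2}=2,\qquad B_{k,j}=B_{k-2,j-2}-\left(\frac{k-3}{2}\right)^2B_{k-2,j}\quad (k\geq 4), \] and in particular $B_{k,k-1}=2$ for all $k\ge 2$.
   Context: The Stirling numbers of the first kind $s_{n,m}$ ($n\ge 1$, $0\le m\le n$) are defined by $x(x+1)\cdots(x+n-1)=\sum_{m=0}^{n}(-1)^{n+m}s_{n,m}x^m$. For integers $k\ge 2$ and $0\le j\le k-1$, \[ B_{k,j}=\sum_{p=0}^{k-j-1}(-1)^{k+j+1}\binom{j+p}{j}\left(\frac{k-1}{2}\right)^p\left(s_{k,j+p+1}+s_{k-1,j+p}\right), \] and $B_{k,j}:=0$ for integers $j<0$ or $j\ge k$. -}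

module Defs where

open import Data.Nat as ℕ using (ℕ; zero; suc; _∸_)
open import Data.Nat.Combinatorics using (_C_)
open import Data.Integer as ℤ using (ℤ; +_; -[1+_])
open import Data.Rational as ℚ using (ℚ; 0ℚ; 1ℚ)
open import Data.Bool using (true; false)
open import Data.List using (List; []; _∷_)

-- polynomials as coefficient lists (lowest degree first)
addP : List ℤ → List ℤ → List ℤ
addP [] q = q
addP (a ∷ p) [] = a ∷ p
addP (a ∷ p) (b ∷ q) = (a ℤ.+ b) ∷ addP p q

scaleP : ℤ → List ℤ → List ℤ
scaleP c [] = []
scaleP c (a ∷ p) = (c ℤ.* a) ∷ scaleP c p

mulXplus : ℤ → List ℤ → List ℤ
mulXplus a p = addP (scaleP a p) (+ 0 ∷ p)

coeff : List ℤ → ℕ → ℤ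
coeff [] m = + 0
coeff (a ∷ p) zero = a
coeff (a ∷ p) (suc m) = coeff p m

rising : ℕ → List ℤ
rising zero = + 1 ∷ []
rising (suc n) = mulXplus (+ n) (rising n)

sgn : ℕ → ℤ
sgn n = -[1+ 0 ] ℤ.^ n

-- Stirling numbers of the first kind s_{n,m}, defined by
-- x(x+1)...(x+n-1) = Σ_m (-1)^{n+m} s_{n,m} x^m  (so s_{n,m} is signed)
s : ℕ → ℕ → ℤ
s n m = sgn (n ℕ.+ m) ℤ.* coeff (rising n) m

powℚ : ℚ → ℕ → ℚ
powℚ q zero = 1ℚ
powℚ q (suc n) = q ℚ.* powℚ q n

-- sumℚ n f = Σ_{p=0}^{n-1} f p  (so the B sum over p = 0..k-j-1 uses n = k-j)
sumℚ : ℕ → (ℕ → ℚ) → ℚ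
sumℚ zero f = 0ℚ
sumℚ (suc n) f = sumℚ n f ℚ.+ f n

-- B_{k,j} for natural j (meaningful for k ≥ 2, 0 ≤ j ≤ k-1);
-- B_{k,j} = 0 for j ≥ k
B : ℕ → ℕ → ℚ
B k j with j ℕ.<ᵇ k
... | false = 0ℚ
... | true = sumℚ (k ∸ j) λ p →
  ((sgn (k ℕ.+ j ℕ.+ 1) ℤ.* + ((j ℕ.+ p) C j)) ℚ./ 1)
  ℚ.* powℚ (+ (k ∸ 1) ℚ./ 2) p
  ℚ.* ((s k (j ℕ.+ p ℕ.+ 1) ℤ.+ s (k ∸ 1) (j ℕ.+ p)) ℚ./ 1)

Bℤ : ℕ → ℤ → ℚ
Bℤ k (+ j) = B k j
Bℤ k -[1+ j ] = 0ℚ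

-- Since s is signed, Σ_m s_{n,m} x^m is the falling factorial x(x − 1)⋯(x − n + 1). Hence
-- Σ_m (s_{k,m+1} + s_{k−1,m}) x^m = (x − 1)⋯(x − k + 2)(2x − k + 1), and B_{k,j} is, up to
-- the sign (−1)^{k+j+1}, twice the coefficient of x^j in this polynomial evaluated at
-- x + (k − 1)/2, i.e. in x ∏_{i=1}^{k−2} (x + (k − 1)/2 − i). Its roots are symmetric about 0,
-- so replacing k by k + 2 multiplies it by x² − ((k − 1)/2)²: this is the recurrence, and by
-- induction its coefficients of x^j with j ≥ 1 and k − j odd are nonzero and alternate in sign.
module Submission where

open import Defs
open import Data.Bool using (true; false; T)
open import Data.List using ([]; _∷_)
open import Data.Nat as ℕ using (ℕ; zero; suc; _≤_; _<_; _∸_; _%_; s≤s)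
import Data.Nat.Properties as ℕP
open import Data.Nat.Combinatorics using (_C_; k>n⇒nCk≡0; nCk+nC[k+1]≡[n+1]C[k+1])
open import Data.Nat.Coprimality using (1-coprimeTo) renaming (sym to coprime-sym)
open import Data.Nat.DivMod using ([m+kn]%n≡m%n)
import Data.Integer.Solver as ℤSolver
open import Data.Integer as ℤ using (ℤ; +_; -[1+_]; _-_)
import Data.Integer.Properties as ℤP
import Data.Rational
open import Data.Rational as ℚ using (ℚ; 0ℚ; 1ℚ; ½; mkℚ; _/_; _+_; _*_; -_; Positive; NonNegative)
import Data.Rational.Properties as ℚP
import Data.Rational.Unnormalised as ℚᵘ
import Data.Rational.Unnormalised.Properties as ℚᵘP
open import Data.Rational.Solver using (module +-*-Solver)
open import Data.Empty using (⊥; ⊥-elim)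
open import Data.Product using (Σ; _×_; _,_)
open import Data.Sum using (_⊎_; inj₁; inj₂)
open import Relation.Binary.PropositionalEquality
open import Relation.Nullary using (yes; no)

sgn-+2 : ∀ n → sgn (suc (suc n)) ≡ sgn n
sgn-+2 n = trans (sym (ℤP.*-assoc -[1+ 0 ] -[1+ 0 ] (sgn n))) (ℤP.*-identityˡ (sgn n))

coeff-addP : ∀ p q m → coeff (addP p q) m ≡ coeff p m ℤ.+ coeff q m
coeff-addP []      q       m       = sym (ℤP.+-identityˡ _)
coeff-addP (a ∷ p) []      m       = sym (ℤP.+-identityʳ _)
coeff-addP (a ∷ p) (b ∷ q) zero    = refl
coeff-addP (a ∷ p) (b ∷ q) (suc m) = coeff-addP p q m

coeff-scaleP : ∀ c p m → coeff (scaleP c p) m ≡ c ℤ.* coeff p m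
coeff-scaleP c []      m       = sym (ℤP.*-zeroʳ c)
coeff-scaleP c (a ∷ p) zero    = refl
coeff-scaleP c (a ∷ p) (suc m) = coeff-scaleP c p m

coeff-mulXplus : ∀ a p m → coeff (mulXplus a p) m ≡ a ℤ.* coeff p m ℤ.+ coeff (+ 0 ∷ p) m
coeff-mulXplus a p m = trans (coeff-addP (scaleP a p) (+ 0 ∷ p) m) (cong (ℤ._+ coeff (+ 0 ∷ p) m) (coeff-scaleP a p m))

s-zero-suc : ∀ m → s 0 (suc m) ≡ + 0
s-zero-suc m = ℤP.*-zeroʳ (sgn (suc m))

s-suc-zero : ∀ n → s (suc n) 0 ≡ ℤ.- + n ℤ.* s n 0
s-suc-zero n rewrite ℕP.+-identityʳ n | coeff-mulXplus (+ n) (rising n) 0 =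
  solve 3 (λ σ a r → (con -[1+ 0 ] :* σ) :* (a :* r :+ con (+ 0)) := :- a :* (σ :* r)) refl
    (sgn n) (+ n) (coeff (rising n) 0)
  where open ℤSolver.+-*-Solver

s-suc-suc : ∀ n m → s (suc n) (suc m) ≡ ℤ.- + n ℤ.* s n (suc m) ℤ.+ s n m
s-suc-suc n m rewrite ℕP.+-suc n m | sgn-+2 (n ℕ.+ m) | coeff-mulXplus (+ n) (rising n) (suc m) =
  solve 4 (λ σ a r₁ r₀ → σ :* (a :* r₁ :+ r₀) := :- a :* ((con -[1+ 0 ] :* σ) :* r₁) :+ σ :* r₀) refl
    (sgn (n ℕ.+ m)) (+ n) (coeff (rising n) (suc m)) (coeff (rising n) m)
  where open ℤSolver.+-*-Solver

open +-*-Solver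

-- Kept opaque: letting the ring solver unfold i / 1 makes type checking blow up.
opaque
  fromℤ : ℤ → ℚ
  fromℤ i = i / 1

  fromℤ-/1 : ∀ i → fromℤ i ≡ i / 1
  fromℤ-/1 i = refl

  fromℤ≡mkℚ : ∀ i → fromℤ i ≡ mkℚ i 0 (coprime-sym (1-coprimeTo ℤ.∣ i ∣))
  fromℤ≡mkℚ i = ℚP.↥p/↧p≡p _

  fromℤ-+ : ∀ i j → fromℤ (i ℤ.+ j) ≡ fromℤ i + fromℤ j
  fromℤ-+ i j rewrite fromℤ≡mkℚ i | fromℤ≡mkℚ j =
    ℚP./-cong (sym (cong₂ ℤ._+_ (ℤP.*-identityʳ i) (ℤP.*-identityʳ j))) refl

  fromℤ-* : ∀ i j → fromℤ (i ℤ.* j) ≡ fromℤ i * fromℤ j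
  fromℤ-* i j rewrite fromℤ≡mkℚ i | fromℤ≡mkℚ j = refl

  fromℤ-neg : ∀ i → fromℤ (ℤ.- i) ≡ - fromℤ i
  fromℤ-neg i rewrite fromℤ≡mkℚ i | fromℤ≡mkℚ (ℤ.- i) = mkℚ-neg i
    where
    mkℚ-neg : ∀ i → mkℚ (ℤ.- i) 0 (coprime-sym (1-coprimeTo ℤ.∣ ℤ.- i ∣))
                  ≡ - mkℚ i 0 (coprime-sym (1-coprimeTo ℤ.∣ i ∣))
    mkℚ-neg (+ zero)  = refl
    mkℚ-neg (+ suc n) = refl
    mkℚ-neg -[1+ n ]  = refl

  fromℤ-0 : fromℤ (+ 0) ≡ 0ℚ
  fromℤ-0 = refl

  fromℤ-1 : fromℤ (+ 1) ≡ 1ℚ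
  fromℤ-1 = refl

fromℕ : ℕ → ℚ
fromℕ n = fromℤ (+ n)

fromℕ-suc : ∀ n → fromℕ (suc n) ≡ fromℕ n + 1ℚ
fromℕ-suc n = begin
  fromℤ (+ suc n)          ≡⟨ cong (λ m → fromℤ (+ m)) (ℕP.+-comm 1 n) ⟩
  fromℤ (+ n ℤ.+ + 1)      ≡⟨ fromℤ-+ (+ n) (+ 1) ⟩
  fromℕ n + fromℤ (+ 1)    ≡⟨ cong (_+_ (fromℕ n)) fromℤ-1 ⟩
  fromℕ n + 1ℚ             ∎
  where open ≡-Reasoning

half : ℕ → ℚ
half n = + n / 2

half+half : ∀ n → half n + half n ≡ fromℕ n
half+half n rewrite fromℤ-/1 (+ n) = ℚP.toℚᵘ-injective (begin
  ℚ.toℚᵘ (half n + half n)                        ≈⟨ ℚP.toℚᵘ-homo-+ (half n) (half n) ⟩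
  ℚ.toℚᵘ (half n) ℚᵘ.+ ℚ.toℚᵘ (half n)           ≈⟨ ℚᵘP.+-cong (ℚP.toℚᵘ-fromℚᵘ (ℚᵘ.mkℚᵘ (+ n) 1)) (ℚP.toℚᵘ-fromℚᵘ (ℚᵘ.mkℚᵘ (+ n) 1)) ⟩
  ℚᵘ.mkℚᵘ (+ n) 1 ℚᵘ.+ ℚᵘ.mkℚᵘ (+ n) 1             ≈⟨ ℚᵘ.*≡* (trans (ℤP.*-identityʳ _) (sym (ℤP.*-distribˡ-+ (+ n) (+ 2) (+ 2)))) ⟩
  ℚᵘ.mkℚᵘ (+ n) 0                                  ≈⟨ ℚP.toℚᵘ-fromℚᵘ (ℚᵘ.mkℚᵘ (+ n) 0) ⟨
  ℚ.toℚᵘ (+ n / 1)                                ∎)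
  where open ℚᵘP.≃-Reasoning

+-double-injective : ∀ x y → x + x ≡ y + y → x ≡ y
+-double-injective x y eq = trans (sym (halve x)) (trans (cong (½ *_) eq) (halve y))
  where
  halve : ∀ x → ½ * (x + x) ≡ x
  halve x = trans (solve 2 (λ h x → h :* (x :+ x) := (h :+ h) :* x) refl ½ x) (ℚP.*-identityˡ x)

half-+2 : ∀ n → half (suc (suc n)) ≡ half n + 1ℚ
half-+2 n = +-double-injective _ _ (begin
  half (suc (suc n)) + half (suc (suc n))  ≡⟨ half+half (suc (suc n)) ⟩
  fromℕ (suc (suc n))                      ≡⟨ fromℕ-suc (suc n) ⟩
  fromℕ (suc n) + 1ℚ                       ≡⟨ cong (_+ 1ℚ) (fromℕ-suc n) ⟩
  fromℕ n + 1ℚ + 1ℚ                        ≡⟨ cong (λ x → x + 1ℚ + 1ℚ) (half+half n) ⟨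
  half n + half n + 1ℚ + 1ℚ                ≡⟨ solve 2 (λ h o → h :+ h :+ o :+ o := (h :+ o) :+ (h :+ o)) refl (half n) 1ℚ ⟩
  (half n + 1ℚ) + (half n + 1ℚ)            ∎)
  where open ≡-Reasoning

sign : ℕ → ℚ
sign n = fromℤ (sgn n)

sign-+2 : ∀ n → sign (suc (suc n)) ≡ sign n
sign-+2 n = cong fromℤ (sgn-+2 n)

sign-double : ∀ n → sign (n ℕ.+ n) ≡ 1ℚ
sign-double zero = fromℤ-1
sign-double (suc n) = begin
  sign (suc (n ℕ.+ suc n))  ≡⟨ cong (λ m → sign (suc m)) (ℕP.+-suc n n) ⟩
  sign (suc (suc (n ℕ.+ n))) ≡⟨ sign-+2 (n ℕ.+ n) ⟩
  sign (n ℕ.+ n)             ≡⟨ sign-double n ⟩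
  1ℚ                         ∎
  where open ≡-Reasoning

sign-suc : ∀ n → sign (suc n) ≡ - sign n
sign-suc n = trans (cong fromℤ (ℤP.-1*i≡-i (sgn n))) (fromℤ-neg (sgn n))

sign*sign : ∀ n → sign n * sign n ≡ 1ℚ
sign*sign zero    = cong (λ x → x * x) fromℤ-1
sign*sign (suc n) rewrite sign-suc n =
  trans (solve 1 (λ x → :- x :* :- x := x :* x) refl (sign n)) (sign*sign n)

*-invertible-≡0 : ∀ {u v} q → v * u ≡ 1ℚ → u * q ≡ 0ℚ → q ≡ 0ℚ
*-invertible-≡0 {u} {v} q vu≡1 uq≡0 = begin
  q              ≡⟨ ℚP.*-identityˡ q ⟨
  1ℚ * q         ≡⟨ cong (_* q) vu≡1 ⟨
  v * u * q      ≡⟨ ℚP.*-assoc v u q ⟩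
  v * (u * q)    ≡⟨ cong (v *_) uq≡0 ⟩
  v * 0ℚ         ≡⟨ ℚP.*-zeroʳ v ⟩
  0ℚ             ∎
  where open ≡-Reasoning

sumℚ-cong : ∀ N {f g : ℕ → ℚ} → f ≗ g → sumℚ N f ≡ sumℚ N g
sumℚ-cong zero    eq = refl
sumℚ-cong (suc N) eq = cong₂ _+_ (sumℚ-cong N eq) (eq N)

sumℚ-+ : ∀ N f g → sumℚ N (λ p → f p + g p) ≡ sumℚ N f + sumℚ N g
sumℚ-+ zero    f g = refl
sumℚ-+ (suc N) f g rewrite sumℚ-+ N f g =
  solve 4 (λ a b c d → a :+ b :+ (c :+ d) := a :+ c :+ (b :+ d)) refl (sumℚ N f) (sumℚ N g) (f N) (g N)

sumℚ-* : ∀ N a f → sumℚ N (λ p → a * f p) ≡ a * sumℚ N f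
sumℚ-* zero    a f = sym (ℚP.*-zeroʳ a)
sumℚ-* (suc N) a f rewrite sumℚ-* N a f = sym (ℚP.*-distribˡ-+ a (sumℚ N f) (f N))

sumℚ-suc : ∀ N f → sumℚ (suc N) f ≡ f 0 + sumℚ N (λ p → f (suc p))
sumℚ-suc zero    f = ℚP.+-comm 0ℚ (f 0)
sumℚ-suc (suc N) f rewrite sumℚ-suc N f = ℚP.+-assoc (f 0) _ _

Coeffs : Set
Coeffs = ℕ → ℚ

constOne : Coeffs
constOne zero    = 1ℚ
constOne (suc m) = 0ℚ

mulX : Coeffs → Coeffs
mulX f zero    = 0ℚ
mulX f (suc m) = f m

mulX² : Coeffs → Coeffs
mulX² f = mulX (mulX f)

mulLinear : ℚ → Coeffs → Coeffs
mulLinear a f zero    = a * f zero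
mulLinear a f (suc m) = a * f (suc m) + f m

DegreeBelow : ℕ → Coeffs → Set
DegreeBelow L f = ∀ m → L ≤ m → f m ≡ 0ℚ

mulLinear-split : ∀ a f m → mulLinear a f m ≡ a * f m + mulX f m
mulLinear-split a f zero    = sym (ℚP.+-identityʳ _)
mulLinear-split a f (suc m) = refl

mulX-cong : ∀ {f g} → f ≗ g → mulX f ≗ mulX g
mulX-cong eq zero    = refl
mulX-cong eq (suc m) = eq m

mulLinear-cong : ∀ a {f g} → f ≗ g → mulLinear a f ≗ mulLinear a g
mulLinear-cong a eq zero    = cong (a *_) (eq zero)
mulLinear-cong a eq (suc m) = cong₂ (λ x y → a * x + y) (eq (suc m)) (eq m)

mulLinear-zero : ∀ f → mulLinear 0ℚ f ≗ mulX f
mulLinear-zero f zero    = ℚP.*-zeroˡ (f 0)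
mulLinear-zero f (suc m) = trans (cong (_+ f m) (ℚP.*-zeroˡ (f (suc m)))) (ℚP.+-identityˡ (f m))

mulX-mulLinear : ∀ a f → mulX (mulLinear a f) ≗ mulLinear a (mulX f)
mulX-mulLinear a f zero          = sym (ℚP.*-zeroʳ a)
mulX-mulLinear a f (suc zero)    = sym (ℚP.+-identityʳ _)
mulX-mulLinear a f (suc (suc m)) = refl

mulLinear-comm : ∀ a b f → mulLinear a (mulLinear b f) ≗ mulLinear b (mulLinear a f)
mulLinear-comm a b f zero =
  solve 3 (λ a b x → a :* (b :* x) := b :* (a :* x)) refl a b (f 0)
mulLinear-comm a b f (suc zero) =
  solve 4 (λ a b x y → a :* (b :* x :+ y) :+ b :* y := b :* (a :* x :+ y) :+ a :* y) refl a b (f 1) (f 0)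
mulLinear-comm a b f (suc (suc m)) =
  solve 5 (λ a b x y z → a :* (b :* x :+ y) :+ (b :* y :+ z) := b :* (a :* x :+ y) :+ (a :* y :+ z))
    refl a b (f (suc (suc m))) (f (suc m)) (f m)

mulLinear-conj : ∀ d f → mulLinear d (mulLinear (- d) f) ≗ λ m → mulX² f m ℚ.- d * d * f m
mulLinear-conj d f zero =
  solve 2 (λ d x → d :* (:- d :* x) := con 0ℚ :- d :* d :* x) refl d (f 0)
mulLinear-conj d f (suc zero) =
  solve 3 (λ d x y → d :* (:- d :* x :+ y) :+ :- d :* y := con 0ℚ :- d :* d :* x) refl d (f 1) (f 0)
mulLinear-conj d f (suc (suc m)) =
  solve 4 (λ d x y z → d :* (:- d :* x :+ y) :+ (:- d :* y :+ z) := z :- d :* d :* x)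
    refl d (f (suc (suc m))) (f (suc m)) (f m)

constOne-degree : DegreeBelow 1 constOne
constOne-degree (suc m) _ = refl

mulLinear-degree : ∀ a {L f} → DegreeBelow L f → DegreeBelow (suc L) (mulLinear a f)
mulLinear-degree a {L} {f} deg (suc m) (s≤s L≤m) = begin
  a * f (suc m) + f m  ≡⟨ cong₂ (λ x y → a * x + y) (deg (suc m) (ℕP.m≤n⇒m≤1+n L≤m)) (deg m L≤m) ⟩
  a * 0ℚ + 0ℚ          ≡⟨ cong (_+ 0ℚ) (ℚP.*-zeroʳ a) ⟩
  0ℚ                   ∎
  where open ≡-Reasoning

mulLinear-leading : ∀ a {L f} → DegreeBelow (suc L) f → mulLinear a f (suc L) ≡ f L
mulLinear-leading a {L} {f} deg = begin
  a * f (suc L) + f L  ≡⟨ cong (λ x → a * x + f L) (deg (suc L) ℕP.≤-refl) ⟩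
  a * 0ℚ + f L         ≡⟨ cong (_+ f L) (ℚP.*-zeroʳ a) ⟩
  0ℚ + f L             ≡⟨ ℚP.+-identityˡ (f L) ⟩
  f L                  ∎
  where open ≡-Reasoning

taylorWeight : ℚ → ℕ → ℕ → ℚ
taylorWeight c j p = fromℕ ((j ℕ.+ p) C j) * powℚ c p

taylorTerm : ℚ → ℕ → Coeffs → ℕ → ℚ
taylorTerm c j f p = taylorWeight c j p * f (j ℕ.+ p)

-- the coefficients of f (x + c), provided f has degree below L
taylor : ℚ → ℕ → Coeffs → Coeffs
taylor c L f j = sumℚ (L ∸ j) (taylorTerm c j f)

taylor-cong : ∀ c L {f g} → f ≗ g → taylor c L f ≗ taylor c L g
taylor-cong c L eq j = sumℚ-cong (L ∸ j) (λ p → cong (taylorWeight c j p *_) (eq (j ℕ.+ p)))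

taylor-+ : ∀ c L f g → taylor c L (λ m → f m + g m) ≗ λ j → taylor c L f j + taylor c L g j
taylor-+ c L f g j = trans (sumℚ-cong (L ∸ j) distrib) (sumℚ-+ (L ∸ j) (taylorTerm c j f) (taylorTerm c j g))
  where
  distrib : ∀ p → taylorTerm c j (λ m → f m + g m) p ≡ taylorTerm c j f p + taylorTerm c j g p
  distrib p = ℚP.*-distribˡ-+ (taylorWeight c j p) (f (j ℕ.+ p)) (g (j ℕ.+ p))

taylor-* : ∀ c L a f → taylor c L (λ m → a * f m) ≗ λ j → a * taylor c L f j
taylor-* c L a f j = trans (sumℚ-cong (L ∸ j) commute) (sumℚ-* (L ∸ j) a (taylorTerm c j f))
  where
  commute : ∀ p → taylorTerm c j (λ m → a * f m) p ≡ a * taylorTerm c j f p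
  commute p = solve 3 (λ u a x → u :* (a :* x) := a :* (u :* x)) refl (taylorWeight c j p) a (f (j ℕ.+ p))

taylor-constOne : ∀ c → taylor c 1 constOne ≗ constOne
taylor-constOne c zero    = trans (ℚP.+-identityˡ _) (cong (λ x → x * 1ℚ * 1ℚ) fromℤ-1)
taylor-constOne c (suc j) = cong (λ N → sumℚ N (taylorTerm c (suc j) constOne)) (ℕP.0∸n≡0 j)

taylor-extend : ∀ c {L f} → DegreeBelow L f → taylor c (suc L) f ≗ taylor c L f
taylor-extend c {L} {f} deg j with j ℕ.≤? L
... | yes j≤L = begin
  sumℚ (suc L ∸ j) (taylorTerm c j f)                        ≡⟨ cong (λ N → sumℚ N (taylorTerm c j f)) (ℕP.+-∸-assoc 1 j≤L) ⟩
  sumℚ (L ∸ j) (taylorTerm c j f) + taylorTerm c j f (L ∸ j) ≡⟨ cong (_+_ (taylor c L f j)) top-vanishes ⟩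
  taylor c L f j + 0ℚ                                        ≡⟨ ℚP.+-identityʳ _ ⟩
  taylor c L f j                                             ∎
  where
  open ≡-Reasoning
  top-vanishes : taylorTerm c j f (L ∸ j) ≡ 0ℚ
  top-vanishes = trans (cong (taylorWeight c j (L ∸ j) *_) (deg _ (ℕP.≤-reflexive (sym (ℕP.m+[n∸m]≡n j≤L))))) (ℚP.*-zeroʳ (taylorWeight c j (L ∸ j)))
... | no j≰L = trans (vanish (ℕP.≰⇒> j≰L)) (sym (vanish (ℕP.<⇒≤ (ℕP.≰⇒> j≰L))))
  where
  vanish : ∀ {N} → N ≤ j → sumℚ (N ∸ j) (taylorTerm c j f) ≡ 0ℚ
  vanish N≤j = cong (λ N → sumℚ N (taylorTerm c j f)) (ℕP.m≤n⇒m∸n≡0 N≤j)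

taylor-pascal-shift : ∀ c j f N →
  sumℚ N (λ p → fromℕ ((j ℕ.+ p) C suc j) * powℚ c p * f (j ℕ.+ p))
    ≡ c * sumℚ (ℕ.pred N) (taylorTerm c (suc j) f)
taylor-pascal-shift c j f zero    = sym (ℚP.*-zeroʳ c)
taylor-pascal-shift c j f (suc N) = begin
  sumℚ (suc N) h                                      ≡⟨ sumℚ-suc N h ⟩
  h 0 + sumℚ N (λ p → h (suc p))                      ≡⟨ cong₂ _+_ h0≡0 (sumℚ-cong N shifted) ⟩
  0ℚ + sumℚ N (λ p → c * taylorTerm c (suc j) f p)    ≡⟨ ℚP.+-identityˡ _ ⟩
  sumℚ N (λ p → c * taylorTerm c (suc j) f p)         ≡⟨ sumℚ-* N c (taylorTerm c (suc j) f) ⟩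
  c * sumℚ N (taylorTerm c (suc j) f)                 ∎
  where
  open ≡-Reasoning
  h : ℕ → ℚ
  h p = fromℕ ((j ℕ.+ p) C suc j) * powℚ c p * f (j ℕ.+ p)
  h0≡0 : h 0 ≡ 0ℚ
  h0≡0 rewrite ℕP.+-identityʳ j | k>n⇒nCk≡0 (ℕP.n<1+n j) | fromℤ-0 = trans (cong (_* f j) (ℚP.*-zeroˡ 1ℚ)) (ℚP.*-zeroˡ (f j))
  shifted : ∀ p → h (suc p) ≡ c * taylorTerm c (suc j) f p
  shifted p rewrite ℕP.+-suc j p =
    solve 4 (λ b c q x → b :* (c :* q) :* x := c :* (b :* q :* x)) refl
      (fromℕ (suc (j ℕ.+ p) C suc j)) c (powℚ c p) (f (suc (j ℕ.+ p)))

taylor-mulX : ∀ c L f → taylor c (suc L) (mulX f) ≗ mulLinear c (taylor c L f)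
taylor-mulX c L f zero = begin
  sumℚ (suc L) (taylorTerm c 0 (mulX f))                 ≡⟨ sumℚ-suc L (taylorTerm c 0 (mulX f)) ⟩
  taylorWeight c 0 0 * 0ℚ + sumℚ L (λ p → taylorWeight c 0 (suc p) * f p)
                                                         ≡⟨ cong₂ _+_ (ℚP.*-zeroʳ (taylorWeight c 0 0)) (sumℚ-cong L pull-c) ⟩
  0ℚ + sumℚ L (λ p → c * taylorTerm c 0 f p)             ≡⟨ ℚP.+-identityˡ _ ⟩
  sumℚ L (λ p → c * taylorTerm c 0 f p)                  ≡⟨ sumℚ-* L c (taylorTerm c 0 f) ⟩
  c * taylor c L f 0                                     ∎
  where
  open ≡-Reasoning
  pull-c : ∀ p → taylorWeight c 0 (suc p) * f p ≡ c * taylorTerm c 0 f p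
  pull-c p = solve 4 (λ one c q x → one :* (c :* q) :* x := c :* (one :* q :* x)) refl
    (fromℕ 1) c (powℚ c p) (f p)
taylor-mulX c L f (suc j) = begin
  sumℚ (L ∸ j) (λ p → taylorWeight c (suc j) p * f (j ℕ.+ p))
    ≡⟨ sumℚ-cong (L ∸ j) pascal ⟩
  sumℚ (L ∸ j) (λ p → taylorTerm c j f p + fromℕ ((j ℕ.+ p) C suc j) * powℚ c p * f (j ℕ.+ p))
    ≡⟨ sumℚ-+ (L ∸ j) (taylorTerm c j f) _ ⟩
  taylor c L f j + sumℚ (L ∸ j) (λ p → fromℕ ((j ℕ.+ p) C suc j) * powℚ c p * f (j ℕ.+ p))
    ≡⟨ cong (_+_ (taylor c L f j)) (taylor-pascal-shift c j f (L ∸ j)) ⟩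
  taylor c L f j + c * sumℚ (ℕ.pred (L ∸ j)) (taylorTerm c (suc j) f)
    ≡⟨ cong (λ N → taylor c L f j + c * sumℚ N (taylorTerm c (suc j) f)) (ℕP.pred[m∸n]≡m∸[1+n] L j) ⟩
  taylor c L f j + c * taylor c L f (suc j)
    ≡⟨ ℚP.+-comm (taylor c L f j) _ ⟩
  c * taylor c L f (suc j) + taylor c L f j
    ∎
  where
  open ≡-Reasoning
  pascal : ∀ p → taylorWeight c (suc j) p * f (j ℕ.+ p)
                 ≡ taylorTerm c j f p + fromℕ ((j ℕ.+ p) C suc j) * powℚ c p * f (j ℕ.+ p)
  pascal p rewrite sym (nCk+nC[k+1]≡[n+1]C[k+1] (j ℕ.+ p) j) | fromℤ-+ (+ ((j ℕ.+ p) C j)) (+ ((j ℕ.+ p) C suc j)) =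
    solve 4 (λ a b q x → (a :+ b) :* q :* x := a :* q :* x :+ b :* q :* x) refl
      (fromℕ ((j ℕ.+ p) C j)) (fromℕ ((j ℕ.+ p) C suc j)) (powℚ c p) (f (j ℕ.+ p))

taylor-mulLinear : ∀ c a {L f} → DegreeBelow L f →
  taylor c (suc L) (mulLinear a f) ≗ mulLinear (a + c) (taylor c L f)
taylor-mulLinear c a {L} {f} deg j = begin
  taylor c (suc L) (mulLinear a f) j                                   ≡⟨ taylor-cong c (suc L) (mulLinear-split a f) j ⟩
  taylor c (suc L) (λ m → a * f m + mulX f m) j                        ≡⟨ taylor-+ c (suc L) (λ m → a * f m) (mulX f) j ⟩
  taylor c (suc L) (λ m → a * f m) j + taylor c (suc L) (mulX f) j     ≡⟨ cong₂ _+_ (taylor-* c (suc L) a f j) (taylor-mulX c L f j) ⟩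
  a * taylor c (suc L) f j + mulLinear c (taylor c L f) j              ≡⟨ cong₂ (λ x y → a * x + y) (taylor-extend c deg j) (mulLinear-split c (taylor c L f) j) ⟩
  a * g j + (c * g j + mulX g j)                                       ≡⟨ solve 4 (λ a c t u → a :* t :+ (c :* t :+ u) := (a :+ c) :* t :+ u) refl a c (g j) (mulX g j) ⟩
  (a + c) * g j + mulX g j                                             ≡⟨ mulLinear-split (a + c) g j ⟨
  mulLinear (a + c) g j                                                ∎
  where
  open ≡-Reasoning
  g : Coeffs
  g = taylor c L f

falling : ℚ → ℕ → Coeffs
falling c zero    = constOne
falling c (suc n) = mulLinear (c ℚ.- fromℕ (suc n)) (falling c n)

falling-degree : ∀ c n → DegreeBelow (suc n) (falling c n)
falling-degree c zero    = constOne-degree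
falling-degree c (suc n) = mulLinear-degree _ (falling-degree c n)

falling-monic : ∀ c n → falling c n n ≡ 1ℚ
falling-monic c zero    = refl
falling-monic c (suc n) = trans (mulLinear-leading (c ℚ.- fromℕ (suc n)) (falling-degree c n)) (falling-monic c n)

falling-suc : ∀ c n → falling (c + 1ℚ) (suc n) ≗ mulLinear c (falling c n)
falling-suc c zero m = cong (λ a → mulLinear a constOne m) (begin
  c + 1ℚ ℚ.- fromℕ 1  ≡⟨ cong (λ x → c + 1ℚ ℚ.- x) fromℤ-1 ⟩
  c + 1ℚ ℚ.- 1ℚ       ≡⟨ solve 1 (λ c → c :+ con 1ℚ :- con 1ℚ := c) refl c ⟩
  c                   ∎)
  where open ≡-Reasoning
falling-suc c (suc n) m = begin
  mulLinear (c + 1ℚ ℚ.- fromℕ (suc (suc n))) (falling (c + 1ℚ) (suc n)) m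
    ≡⟨ mulLinear-cong _ (falling-suc c n) m ⟩
  mulLinear (c + 1ℚ ℚ.- fromℕ (suc (suc n))) (mulLinear c (falling c n)) m
    ≡⟨ mulLinear-comm _ c (falling c n) m ⟩
  mulLinear c (mulLinear (c + 1ℚ ℚ.- fromℕ (suc (suc n))) (falling c n)) m
    ≡⟨ cong (λ a → mulLinear c (mulLinear a (falling c n)) m) root ⟩
  mulLinear c (falling c (suc n)) m
    ∎
  where
  open ≡-Reasoning
  root : c + 1ℚ ℚ.- fromℕ (suc (suc n)) ≡ c ℚ.- fromℕ (suc n)
  root rewrite fromℕ-suc (suc n) = solve 2 (λ c v → c :+ con 1ℚ :- (v :+ con 1ℚ) := c :- v) refl c (fromℕ (suc n))

taylor-falling : ∀ c b n → taylor c (suc n) (falling b n) ≗ falling (b + c) n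
taylor-falling c b zero    = taylor-constOne c
taylor-falling c b (suc n) j = begin
  taylor c (suc (suc n)) (mulLinear (b ℚ.- fromℕ (suc n)) (falling b n)) j
    ≡⟨ taylor-mulLinear c _ (falling-degree b n) j ⟩
  mulLinear (b ℚ.- fromℕ (suc n) + c) (taylor c (suc n) (falling b n)) j
    ≡⟨ mulLinear-cong _ (taylor-falling c b n) j ⟩
  mulLinear (b ℚ.- fromℕ (suc n) + c) (falling (b + c) n) j
    ≡⟨ cong (λ a → mulLinear a (falling (b + c) n) j) root ⟩
  falling (b + c) (suc n) j
    ∎
  where
  open ≡-Reasoning
  root : b ℚ.- fromℕ (suc n) + c ≡ b + c ℚ.- fromℕ (suc n)
  root = solve 3 (λ b v c → b :- v :+ c := b :+ c :- v) refl b (fromℕ (suc n)) c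

sℚ : ℕ → Coeffs
sℚ n m = fromℤ (s n m)

sℚ-zero : sℚ 0 ≗ constOne
sℚ-zero zero    = fromℤ-1
sℚ-zero (suc m) = trans (cong fromℤ (s-zero-suc m)) fromℤ-0

sℚ-suc : ∀ n → sℚ (suc n) ≗ mulLinear (- fromℕ n) (sℚ n)
sℚ-suc n zero = begin
  fromℤ (s (suc n) 0)              ≡⟨ cong fromℤ (s-suc-zero n) ⟩
  fromℤ (ℤ.- + n ℤ.* s n 0)        ≡⟨ fromℤ-* (ℤ.- + n) (s n 0) ⟩
  fromℤ (ℤ.- + n) * sℚ n 0         ≡⟨ cong (_* sℚ n 0) (fromℤ-neg (+ n)) ⟩
  - fromℕ n * sℚ n 0               ∎
  where open ≡-Reasoning
sℚ-suc n (suc m) = begin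
  fromℤ (s (suc n) (suc m))                            ≡⟨ cong fromℤ (s-suc-suc n m) ⟩
  fromℤ (ℤ.- + n ℤ.* s n (suc m) ℤ.+ s n m)            ≡⟨ fromℤ-+ (ℤ.- + n ℤ.* s n (suc m)) (s n m) ⟩
  fromℤ (ℤ.- + n ℤ.* s n (suc m)) + sℚ n m             ≡⟨ cong (_+ sℚ n m) (fromℤ-* (ℤ.- + n) (s n (suc m))) ⟩
  fromℤ (ℤ.- + n) * sℚ n (suc m) + sℚ n m              ≡⟨ cong (λ x → x * sℚ n (suc m) + sℚ n m) (fromℤ-neg (+ n)) ⟩
  - fromℕ n * sℚ n (suc m) + sℚ n m                    ∎
  where open ≡-Reasoning

sℚ-falling : ∀ n → sℚ (suc n) ≗ mulX (falling 0ℚ n)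
sℚ-falling zero m = begin
  sℚ 1 m                                ≡⟨ sℚ-suc 0 m ⟩
  mulLinear (- fromℕ 0) (sℚ 0) m        ≡⟨ cong (λ a → mulLinear (- a) (sℚ 0) m) fromℤ-0 ⟩
  mulLinear 0ℚ (sℚ 0) m                 ≡⟨ mulLinear-cong 0ℚ sℚ-zero m ⟩
  mulLinear 0ℚ constOne m               ≡⟨ mulLinear-zero constOne m ⟩
  mulX constOne m                       ∎
  where open ≡-Reasoning
sℚ-falling (suc n) m = begin
  sℚ (suc (suc n)) m                                          ≡⟨ sℚ-suc (suc n) m ⟩
  mulLinear (- fromℕ (suc n)) (sℚ (suc n)) m                  ≡⟨ mulLinear-cong _ (sℚ-falling n) m ⟩
  mulLinear (- fromℕ (suc n)) (mulX (falling 0ℚ n)) m         ≡⟨ mulX-mulLinear _ (falling 0ℚ n) m ⟨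
  mulX (mulLinear (- fromℕ (suc n)) (falling 0ℚ n)) m         ≡⟨ cong (λ a → mulX (mulLinear a (falling 0ℚ n)) m) (ℚP.+-identityˡ _) ⟨
  mulX (falling 0ℚ (suc n)) m                                 ∎
  where open ≡-Reasoning

2ℚ : ℚ
2ℚ = 1ℚ + 1ℚ

stirlingSum : ℕ → Coeffs
stirlingSum k m = fromℤ (s k (suc m) ℤ.+ s (k ∸ 1) m)

stirlingSum-factor : ∀ n → stirlingSum (suc (suc n)) ≗ λ m → 2ℚ * mulLinear (- half (suc n)) (falling 0ℚ n) m
stirlingSum-factor n m = begin
  fromℤ (s (suc (suc n)) (suc m) ℤ.+ s (suc n) m)        ≡⟨ fromℤ-+ (s (suc (suc n)) (suc m)) (s (suc n) m) ⟩
  sℚ (suc (suc n)) (suc m) + sℚ (suc n) m                ≡⟨ cong₂ _+_ (sℚ-falling (suc n) (suc m)) (sℚ-falling n m) ⟩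
  mulLinear (0ℚ ℚ.- fromℕ (suc n)) F m + mulX F m        ≡⟨ cong (_+ mulX F m) (mulLinear-split _ F m) ⟩
  (0ℚ ℚ.- fromℕ (suc n)) * F m + mulX F m + mulX F m     ≡⟨ cong (λ x → (0ℚ ℚ.- x) * F m + mulX F m + mulX F m) (half+half (suc n)) ⟨
  (0ℚ ℚ.- (c + c)) * F m + mulX F m + mulX F m           ≡⟨ solve 3 (λ c x y → (con 0ℚ :- (c :+ c)) :* x :+ y :+ y := (con 1ℚ :+ con 1ℚ) :* (:- c :* x :+ y))
                                                              refl c (F m) (mulX F m) ⟩
  2ℚ * (- c * F m + mulX F m)                            ≡⟨ cong (2ℚ *_) (mulLinear-split (- c) F m) ⟨
  2ℚ * mulLinear (- c) F m                               ∎
  where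
  open ≡-Reasoning
  c : ℚ
  c = half (suc n)
  F : Coeffs
  F = falling 0ℚ n

-- The polynomial of index k = n + 2: x ∏_{i=1}^{n} (x + (n+1)/2 − i), with roots symmetric about 0.
central : ℕ → Coeffs
central n = mulX (falling (half (suc n)) n)

taylor-stirlingSum : ∀ n → taylor (half (suc n)) (suc (suc n)) (stirlingSum (suc (suc n))) ≗ λ j → 2ℚ * central n j
taylor-stirlingSum n j = begin
  taylor c (suc (suc n)) (stirlingSum (suc (suc n))) j          ≡⟨ taylor-cong c (suc (suc n)) (stirlingSum-factor n) j ⟩
  taylor c (suc (suc n)) (λ m → 2ℚ * mulLinear (- c) F m) j     ≡⟨ taylor-* c (suc (suc n)) 2ℚ (mulLinear (- c) F) j ⟩
  2ℚ * taylor c (suc (suc n)) (mulLinear (- c) F) j             ≡⟨ cong (2ℚ *_) (taylor-mulLinear c (- c) (falling-degree 0ℚ n) j) ⟩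
  2ℚ * mulLinear (- c + c) (taylor c (suc n) F) j               ≡⟨ cong (2ℚ *_) (mulLinear-cong _ (taylor-falling c 0ℚ n) j) ⟩
  2ℚ * mulLinear (- c + c) (falling (0ℚ + c) n) j               ≡⟨ cong₂ (λ a b → 2ℚ * mulLinear a (falling b n) j) (ℚP.+-inverseˡ c) (ℚP.+-identityˡ c) ⟩
  2ℚ * mulLinear 0ℚ (falling c n) j                             ≡⟨ cong (2ℚ *_) (mulLinear-zero (falling c n) j) ⟩
  2ℚ * central n j                                              ∎
  where
  open ≡-Reasoning
  c : ℚ
  c = half (suc n)
  F : Coeffs
  F = falling 0ℚ n

B-taylor : ∀ k j → B k j ≡ sign (k ℕ.+ j ℕ.+ 1) * taylor (half (k ∸ 1)) k (stirlingSum k) j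
B-taylor k j with j ℕ.<ᵇ k in j<ᵇk
... | false = sym (begin
  σ * sumℚ (k ∸ j) (taylorTerm c j (stirlingSum k))  ≡⟨ cong (λ N → σ * sumℚ N (taylorTerm c j (stirlingSum k))) (ℕP.m≤n⇒m∸n≡0 k≤j) ⟩
  σ * 0ℚ                                            ≡⟨ ℚP.*-zeroʳ σ ⟩
  0ℚ                                                ∎)
  where
  open ≡-Reasoning
  σ = sign (k ℕ.+ j ℕ.+ 1)
  c = half (k ∸ 1)
  k≤j : k ≤ j
  k≤j = ℕP.≮⇒≥ (λ j<k → subst T j<ᵇk (ℕP.<⇒<ᵇ j<k))
... | true = trans (sumℚ-cong (k ∸ j) term) (sumℚ-* (k ∸ j) σ (taylorTerm c j (stirlingSum k)))
  where
  σ = sign (k ℕ.+ j ℕ.+ 1)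
  c = half (k ∸ 1)
  term : ∀ p → ((sgn (k ℕ.+ j ℕ.+ 1) ℤ.* + ((j ℕ.+ p) C j)) / 1) * powℚ c p * ((s k (j ℕ.+ p ℕ.+ 1) ℤ.+ s (k ∸ 1) (j ℕ.+ p)) / 1)
               ≡ σ * taylorTerm c j (stirlingSum k) p
  term p
    rewrite sym (fromℤ-/1 (sgn (k ℕ.+ j ℕ.+ 1) ℤ.* + ((j ℕ.+ p) C j)))
          | sym (fromℤ-/1 (s k (j ℕ.+ p ℕ.+ 1) ℤ.+ s (k ∸ 1) (j ℕ.+ p)))
          | fromℤ-* (sgn (k ℕ.+ j ℕ.+ 1)) (+ ((j ℕ.+ p) C j))
          | ℕP.+-comm (j ℕ.+ p) 1
    = solve 4 (λ σ b q x → σ :* b :* q :* x := σ :* (b :* q :* x)) refl σ (fromℕ ((j ℕ.+ p) C j)) (powℚ c p) (stirlingSum k (j ℕ.+ p))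

B-central : ∀ n j → B (suc (suc n)) j ≡ sign (n ℕ.+ j ℕ.+ 1) * (2ℚ * central n j)
B-central n j = begin
  B (suc (suc n)) j                                                                  ≡⟨ B-taylor (suc (suc n)) j ⟩
  sign (suc (suc (n ℕ.+ j ℕ.+ 1))) * taylor (half (suc n)) (suc (suc n)) (stirlingSum (suc (suc n))) j
                                                                                     ≡⟨ cong₂ _*_ (sign-+2 (n ℕ.+ j ℕ.+ 1)) (taylor-stirlingSum n j) ⟩
  sign (n ℕ.+ j ℕ.+ 1) * (2ℚ * central n j)                                           ∎
  where open ≡-Reasoning

central-+2 : ∀ n → central (suc (suc n)) ≗ λ m → mulX² (central n) m ℚ.- half (suc n) * half (suc n) * central n m
central-+2 n m = begin
  mulX (falling (half (suc (suc (suc n)))) (suc (suc n))) m  ≡⟨ cong (λ a → mulX (falling a (suc (suc n))) m) (half-+2 (suc n)) ⟩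
  mulX (falling (c + 1ℚ) (suc (suc n))) m                   ≡⟨ mulX-cong (falling-suc c (suc n)) m ⟩
  mulX (mulLinear c (falling c (suc n))) m                  ≡⟨ mulX-mulLinear c (falling c (suc n)) m ⟩
  mulLinear c (mulX (mulLinear (c ℚ.- fromℕ (suc n)) F)) m  ≡⟨ cong (λ a → mulLinear c (mulX (mulLinear a F)) m) mirror ⟩
  mulLinear c (mulX (mulLinear (- c) F)) m                  ≡⟨ mulLinear-cong c (mulX-mulLinear (- c) F) m ⟩
  mulLinear c (mulLinear (- c) (mulX F)) m                  ≡⟨ mulLinear-conj c (mulX F) m ⟩
  mulX² (central n) m ℚ.- c * c * central n m               ∎
  where
  open ≡-Reasoning
  c : ℚ
  c = half (suc n)
  F : Coeffs
  F = falling c n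
  mirror : c ℚ.- fromℕ (suc n) ≡ - c
  mirror rewrite sym (half+half (suc n)) = solve 1 (λ c → c :- (c :+ c) := :- c) refl c

+-double-suc : ∀ i e → i ℕ.+ (suc e ℕ.+ suc e) ≡ suc (suc (i ℕ.+ (e ℕ.+ e)))
+-double-suc i e = begin
  i ℕ.+ suc (e ℕ.+ suc e)      ≡⟨ cong (λ x → i ℕ.+ suc x) (ℕP.+-suc e e) ⟩
  i ℕ.+ suc (suc (e ℕ.+ e))    ≡⟨ ℕP.+-suc i (suc (e ℕ.+ e)) ⟩
  suc (i ℕ.+ suc (e ℕ.+ e))    ≡⟨ cong suc (ℕP.+-suc i (e ℕ.+ e)) ⟩
  suc (suc (i ℕ.+ (e ℕ.+ e)))  ∎
  where open ≡-Reasoning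

central-sign : ∀ n e i → i ℕ.+ (e ℕ.+ e) ≡ n → Positive (sign e * central n (suc i))
central-sign n zero i eq = subst Positive (sym leading) _
  where
  leading : sign 0 * central n (suc i) ≡ 1ℚ
  leading = begin
    sign 0 * central n (suc i)  ≡⟨ cong₂ (λ σ m → σ * central n (suc m)) fromℤ-1 (trans (sym (ℕP.+-identityʳ i)) eq) ⟩
    1ℚ * central n (suc n)      ≡⟨ ℚP.*-identityˡ (central n (suc n)) ⟩
    falling (half (suc n)) n n  ≡⟨ falling-monic (half (suc n)) n ⟩
    1ℚ                          ∎
    where open ≡-Reasoning
central-sign zero (suc e) i eq with trans (sym (+-double-suc i e)) eq
... | ()
central-sign (suc zero) (suc e) i eq with trans (sym (+-double-suc i e)) eq
... | ()
central-sign (suc (suc n)) (suc e) i eq =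
  subst Positive (sym expand) (ℚP.nonNeg+pos⇒pos outer {{outer-nonNeg i eq}} inner {{inner-pos}})
  where
  c = half (suc n)
  Q = central n
  outer = sign (suc e) * mulX² Q (suc i)
  inner = c * c * (sign e * Q (suc i))
  c-pos : Positive c
  c-pos = ℚP.normalize-pos (suc n) 2
  inner-pos : Positive inner
  inner-pos = ℚP.pos*pos⇒pos (c * c) {{ℚP.pos*pos⇒pos c {{c-pos}} c {{c-pos}}}} (sign e * Q (suc i))
    {{central-sign n e i (ℕP.suc-injective (ℕP.suc-injective (trans (sym (+-double-suc i e)) eq)))}}
  outer-nonNeg : ∀ i → i ℕ.+ (suc e ℕ.+ suc e) ≡ suc (suc n) → NonNegative (sign (suc e) * mulX² Q (suc i))
  outer-nonNeg zero          _  = subst NonNegative (sym (ℚP.*-zeroʳ (sign (suc e)))) _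
  outer-nonNeg (suc zero)    _  = subst NonNegative (sym (ℚP.*-zeroʳ (sign (suc e)))) _
  outer-nonNeg (suc (suc i)) eq = ℚP.pos⇒nonNeg (sign (suc e) * Q (suc i))
    {{central-sign n (suc e) i (ℕP.suc-injective (ℕP.suc-injective eq))}}
  expand : sign (suc e) * central (suc (suc n)) (suc i) ≡ outer + inner
  expand = begin
    sign (suc e) * central (suc (suc n)) (suc i)               ≡⟨ cong₂ _*_ (sign-suc e) (central-+2 n (suc i)) ⟩
    - sign e * (mulX² Q (suc i) ℚ.- c * c * Q (suc i))         ≡⟨ distrib (sign e) (mulX² Q (suc i)) c (Q (suc i)) ⟩
    - sign e * mulX² Q (suc i) + inner                         ≡⟨ cong (λ σ → σ * mulX² Q (suc i) + inner) (sign-suc e) ⟨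
    outer + inner                                              ∎
    where
    open ≡-Reasoning
    distrib : ∀ σ a c b → - σ * (a ℚ.- c * c * b) ≡ - σ * a + c * c * (σ * b)
    distrib = solve 4 (λ σ a c b → :- σ :* (a :- c :* c :* b) := :- σ :* a :+ c :* c :* (σ :* b)) refl

B-nonzero : ∀ n e i → i ℕ.+ (e ℕ.+ e) ≡ n → B (suc (suc n)) (suc i) ≢ 0ℚ
B-nonzero n e i eq B≡0 = positive-zero (subst Positive (trans (cong (sign e *_) Q≡0) (ℚP.*-zeroʳ (sign e))) (central-sign n e i eq))
  where
  σ = sign (n ℕ.+ suc i ℕ.+ 1)
  Q = central n (suc i)
  2Q≡0 : 2ℚ * Q ≡ 0ℚ
  2Q≡0 = *-invertible-≡0 {u = σ} {v = σ} (2ℚ * Q) (sign*sign (n ℕ.+ suc i ℕ.+ 1)) (trans (sym (B-central n (suc i))) B≡0)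
  Q≡0 : Q ≡ 0ℚ
  Q≡0 = *-invertible-≡0 {v = ½} Q refl 2Q≡0
  positive-zero : Positive 0ℚ → ⊥
  positive-zero ()

B-leading : ∀ n → B (suc (suc n)) (suc n) ≡ + 2 / 1
B-leading n = begin
  B (suc (suc n)) (suc n)                                     ≡⟨ B-central n (suc n) ⟩
  sign (n ℕ.+ suc n ℕ.+ 1) * (2ℚ * central n (suc n))          ≡⟨ cong₂ (λ σ x → σ * (2ℚ * x)) σ≡1 (falling-monic (half (suc n)) n) ⟩
  1ℚ * (2ℚ * 1ℚ)                                              ≡⟨⟩
  + 2 / 1                                                     ∎
  where
  open ≡-Reasoning
  σ≡1 : sign (n ℕ.+ suc n ℕ.+ 1) ≡ 1ℚ
  σ≡1 = trans (cong sign (ℕP.+-comm (n ℕ.+ suc n) 1)) (sign-double (suc n))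

B-recurrence : ∀ n j → B (suc (suc (suc (suc n)))) j
                         ≡ Bℤ (suc (suc n)) (+ j - + 2) ℚ.- half (suc n) * half (suc n) * B (suc (suc n)) j
B-recurrence n j = begin
  B (suc (suc (suc (suc n)))) j                           ≡⟨ B-central (suc (suc n)) j ⟩
  sign (suc (suc (n ℕ.+ j ℕ.+ 1))) * (2ℚ * central (suc (suc n)) j)
                                                          ≡⟨ cong₂ (λ σ x → σ * (2ℚ * x)) (sign-+2 (n ℕ.+ j ℕ.+ 1)) (central-+2 n j) ⟩
  σ * (2ℚ * (mulX² Q j ℚ.- c * c * Q j))                   ≡⟨ distrib σ 2ℚ (mulX² Q j) c (Q j) ⟩
  σ * (2ℚ * mulX² Q j) ℚ.- c * c * (σ * (2ℚ * Q j))        ≡⟨ cong₂ (λ x y → x ℚ.- c * c * y) (shifted j) (sym (B-central n j)) ⟩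
  Bℤ (suc (suc n)) (+ j - + 2) ℚ.- c * c * B (suc (suc n)) j  ∎
  where
  open ≡-Reasoning
  σ = sign (n ℕ.+ j ℕ.+ 1)
  c = half (suc n)
  Q = central n
  distrib : ∀ σ t a c q → σ * (t * (a ℚ.- c * c * q)) ≡ σ * (t * a) ℚ.- c * c * (σ * (t * q))
  distrib = solve 5 (λ σ t a c q → σ :* (t :* (a :- c :* c :* q)) := σ :* (t :* a) :- c :* c :* (σ :* (t :* q))) refl
  shifted : ∀ j → sign (n ℕ.+ j ℕ.+ 1) * (2ℚ * mulX² Q j) ≡ Bℤ (suc (suc n)) (+ j - + 2)
  shifted zero          = trans (cong (sign (n ℕ.+ 0 ℕ.+ 1) *_) (ℚP.*-zeroʳ 2ℚ)) (ℚP.*-zeroʳ (sign (n ℕ.+ 0 ℕ.+ 1)))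
  shifted (suc zero)    = trans (cong (sign (n ℕ.+ 1 ℕ.+ 1) *_) (ℚP.*-zeroʳ 2ℚ)) (ℚP.*-zeroʳ (sign (n ℕ.+ 1 ℕ.+ 1)))
  shifted (suc (suc j)) = begin
    sign (n ℕ.+ suc (suc j) ℕ.+ 1) * (2ℚ * Q j)        ≡⟨ cong (λ m → sign (m ℕ.+ 1) * (2ℚ * Q j)) (trans (ℕP.+-suc n (suc j)) (cong suc (ℕP.+-suc n j))) ⟩
    sign (suc (suc (n ℕ.+ j ℕ.+ 1))) * (2ℚ * Q j)      ≡⟨ cong (_* (2ℚ * Q j)) (sign-+2 (n ℕ.+ j ℕ.+ 1)) ⟩
    sign (n ℕ.+ j ℕ.+ 1) * (2ℚ * Q j)                  ≡⟨ B-central n j ⟨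
    B (suc (suc n)) j                                  ∎

even⊎odd : ∀ t → (Σ ℕ λ e → t ≡ e ℕ.+ e) ⊎ (Σ ℕ λ e → t ≡ suc (e ℕ.+ e))
even⊎odd zero = inj₁ (0 , refl)
even⊎odd (suc t) with even⊎odd t
... | inj₁ (e , t≡e+e)   = inj₂ (e , cong suc t≡e+e)
... | inj₂ (e , t≡1+e+e) = inj₁ (suc e , trans (cong suc t≡1+e+e) (sym (cong suc (ℕP.+-suc e e))))

opposite-parity⇒even-gap : ∀ n i → i ≤ n → suc (suc n) % 2 ≢ suc i % 2 → Σ ℕ λ e → i ℕ.+ (e ℕ.+ e) ≡ n
opposite-parity⇒even-gap n i i≤n parity with even⊎odd (n ∸ i)
... | inj₁ (e , gap) = e , trans (cong (i ℕ.+_) (sym gap)) (ℕP.m+[n∸m]≡n i≤n)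
... | inj₂ (e , gap) = ⊥-elim (parity (trans (cong (_% 2) k≡) ([m+kn]%n≡m%n (suc i) (suc e) 2)))
  where
  k≡ : suc (suc n) ≡ suc i ℕ.+ suc e ℕ.* 2
  k≡ = begin
    suc (suc n)                      ≡⟨ cong (λ m → suc (suc m)) (ℕP.m+[n∸m]≡n i≤n) ⟨
    suc (suc (i ℕ.+ (n ∸ i)))        ≡⟨ cong (λ t → suc (suc (i ℕ.+ t))) gap ⟩
    suc (suc (i ℕ.+ suc (e ℕ.+ e)))  ≡⟨ cong suc (ℕP.+-suc i (suc (e ℕ.+ e))) ⟨
    suc (i ℕ.+ suc (suc (e ℕ.+ e)))  ≡⟨ cong (λ x → suc (i ℕ.+ suc (suc x))) (trans (cong (e ℕ.+_) (sym (ℕP.+-identityʳ e))) (ℕP.*-comm 2 e)) ⟩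
    suc i ℕ.+ suc e ℕ.* 2            ∎
    where open ≡-Reasoning

theorem5 : ((k j : ℕ) → 2 ≤ k → j < k → j ≢ 0 → k % 2 ≢ j % 2 → B k j ≢ 0ℚ)
    × (B 2 1 ≡ + 2 / 1)
    × (B 3 2 ≡ + 2 / 1)
    × ((k j : ℕ) → 4 ≤ k → j < k →
    B k j ≡ Bℤ (k ∸ 2) (+ j - + 2) Data.Rational.-
    (+ (k ∸ 3) / 2) * (+ (k ∸ 3) / 2) * B (k ∸ 2) j)
    × ((k : ℕ) → 2 ≤ k → B k (k ∸ 1) ≡ + 2 / 1)
theorem5 = nonzero , B-leading 0 , B-leading 1 , recurrence , leading
  where
  nonzero : (k j : ℕ) → 2 ≤ k → j < k → j ≢ 0 → k % 2 ≢ j % 2 → B k j ≢ 0ℚ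
  nonzero zero          _       ()
  nonzero (suc zero)    _       (s≤s ())
  nonzero (suc (suc n)) zero    _ _ j≢0 _ = ⊥-elim (j≢0 refl)
  nonzero (suc (suc n)) (suc i) _ (s≤s (s≤s i≤n)) _ parity =
    let e , gap = opposite-parity⇒even-gap n i i≤n parity in B-nonzero n e i gap
  recurrence : (k j : ℕ) → 4 ≤ k → j < k →
    B k j ≡ Bℤ (k ∸ 2) (+ j - + 2) Data.Rational.- (+ (k ∸ 3) / 2) * (+ (k ∸ 3) / 2) * B (k ∸ 2) j
  recurrence zero                       _ ()
  recurrence (suc zero)                 _ (s≤s ())
  recurrence (suc (suc zero))           _ (s≤s (s≤s ()))
  recurrence (suc (suc (suc zero)))     _ (s≤s (s≤s (s≤s ())))
  recurrence (suc (suc (suc (suc n))))  j _ _ = B-recurrence n j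
  leading : (k : ℕ) → 2 ≤ k → B k (k ∸ 1) ≡ + 2 / 1
  leading zero          ()
  leading (suc zero)    (s≤s ())
  leading (suc (suc n)) _ = B-leading n
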